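{- There exists a formula $J(z)$ with one free variable in the language of $\mathsf{ID}^{(4)}$ such that: (1) $\mathsf{ID}^{(4)}\vdash J(t)$ for each variable-free term $t$; (2) $\mathsf{ID}^{(4)}\vdash\forall x\,\forall z\,[J(z)\to\bigwedge_{a\in\{0,1\}}(z=xa\to a\preceq_{\mathsf{suff}}z)]$; (3) $\mathsf{ID}^{(4)}\vdash\forall x y\,\forall z\,[J(z)\to\bigwedge_{a\in\{0,1\}}((z=ya\wedge x\preceq_{\mathsf{suff}}y)\to xa\preceq_{\mathsf{suff}}z)]$; (4) $\mathsf{ID}^{(4)}\vdash\forall z\,[J(z)\to(z=0\vee z=1\vee\exists u\,[u\preceq_{\mathsf{sub}}z\wedge(z=u0\vee z=u1)])]$; (5) $\mathsf{ID}^{(4)}\vdash\forall z\,\forall u\,[(J(z)\wedge u\preceq_{\mathsf{sub}}z)\to J(u)]$.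
   Context: Juxtaposition $xy$ denotes $x\circ y$. Biterals: $\overline{\mathbf 0}\equiv 0$, $\overline{\mathbf 1}\equiv 1$, $\overline{\alpha\mathbf 0}\equiv(\overline{\alpha}\circ 0)$, $\overline{\alpha\mathbf 1}\equiv(\overline{\alpha}\circ 1)$; $\mathsf{Pref}(\alpha)$, $\mathsf{Suff}(\alpha)$, $\mathsf{Sub}(\alpha)$ are the sets of nonempty prefixes, suffixes, substrings of $\alpha$ (including $\alpha$). $\mathsf{ID}^{(4)}$ is the theory in the language $\{0,1,\circ,\preceq,\preceq_{\mathsf{suff}},\preceq_{\mathsf{sub}}\}$ with axioms $\forall xyz\,[(xy)z=x(yz)]$; $\forall xy\,[x\neq y\to(x0\neq y0\wedge x1\neq y1)]$; $\forall xy\,[x0\neq y1]$; $\forall xy\,[xy\neq 0]$; $\forall xy\,[xy\neq 1]$; and for each nonempty binary string $\alpha$: $\forall x\,[x\preceq\overline{\alpha}\leftrightarrow\bigvee_{\gamma\in\mathsf{Pref}(\alpha)}x=\overline{\gamma}]$, $\forall x\,[x\preceq_{\mathsf{suff}}\overline{\alpha}\leftrightarrow\bigvee_{\gamma\in\mathsf{Suff}(\alpha)}x=\overline{\gamma}]$, $\forall x\,[x\preceq_{\mathsf{sub}}\overline{\alpha}\leftrightarrow\bigvee_{\gamma\in\mathsf{Sub}(\alpha)}x=\overline{\gamma}]$. -}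

module Defs where

open import Data.Nat using (ℕ; zero; suc)
open import Data.Fin using (Fin; zero; suc)
open import Data.Bool using (Bool; true; false)
open import Data.List using (List; []; _∷_; map; foldr; concatMap)
open import Data.List.NonEmpty using (List⁺; _∷_; _∷⁺_; head; tail)
open import Data.List.Membership.Propositional using (_∈_)

-- Sentences are Formula 0; var zero is the most recently
-- bound variable.

infixl 7 _∘_
infix 5 _≐_ _≼_ _≼suff_ _≼sub_ _≠_
infixr 3 _∧'_
infixr 2 _∨'_
infixr 1 _⇒_

data Term (n : ℕ) : Set where
  var : Fin n → Term n
  𝟘 𝟙 : Term n
  _∘_ : Term n → Term n → Term n

data Formula (n : ℕ) : Set where
  _≐_ _≼_ _≼suff_ _≼sub_ : Term n → Term n → Formula n
  ⊥'  : Formula n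
  _⇒_ _∧'_ _∨'_ : Formula n → Formula n → Formula n
  ∀' ∃' : Formula (suc n) → Formula n

¬' : ∀ {n} → Formula n → Formula n
¬' φ = φ ⇒ ⊥'

_⇔'_ : ∀ {n} → Formula n → Formula n → Formula n
φ ⇔' ψ = (φ ⇒ ψ) ∧' (ψ ⇒ φ)

_≠_ : ∀ {n} → Term n → Term n → Formula n
s ≠ t = ¬' (s ≐ t)

⋁ : ∀ {n} → List (Formula n) → Formula n
⋁ = foldr _∨'_ ⊥'

renT : ∀ {n m} → (Fin n → Fin m) → Term n → Term m
renT ρ (var i) = var (ρ i)
renT ρ 𝟘 = 𝟘
renT ρ 𝟙 = 𝟙
renT ρ (s ∘ t) = renT ρ s ∘ renT ρ t

liftR : ∀ {n m} → (Fin n → Fin m) → Fin (suc n) → Fin (suc m)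
liftR ρ zero = zero
liftR ρ (suc i) = suc (ρ i)

ren : ∀ {n m} → (Fin n → Fin m) → Formula n → Formula m
ren ρ (s ≐ t) = renT ρ s ≐ renT ρ t
ren ρ (s ≼ t) = renT ρ s ≼ renT ρ t
ren ρ (s ≼suff t) = renT ρ s ≼suff renT ρ t
ren ρ (s ≼sub t) = renT ρ s ≼sub renT ρ t
ren ρ ⊥' = ⊥'
ren ρ (φ ⇒ ψ) = ren ρ φ ⇒ ren ρ ψ
ren ρ (φ ∧' ψ) = ren ρ φ ∧' ren ρ ψ
ren ρ (φ ∨' ψ) = ren ρ φ ∨' ren ρ ψ
ren ρ (∀' φ) = ∀' (ren (liftR ρ) φ)
ren ρ (∃' φ) = ∃' (ren (liftR ρ) φ)

subT : ∀ {n m} → (Fin n → Term m) → Term n → Term m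
subT σ (var i) = σ i
subT σ 𝟘 = 𝟘
subT σ 𝟙 = 𝟙
subT σ (s ∘ t) = subT σ s ∘ subT σ t

liftS : ∀ {n m} → (Fin n → Term m) → Fin (suc n) → Term (suc m)
liftS σ zero = var zero
liftS σ (suc i) = renT suc (σ i)

sub : ∀ {n m} → (Fin n → Term m) → Formula n → Formula m
sub σ (s ≐ t) = subT σ s ≐ subT σ t
sub σ (s ≼ t) = subT σ s ≼ subT σ t
sub σ (s ≼suff t) = subT σ s ≼suff subT σ t
sub σ (s ≼sub t) = subT σ s ≼sub subT σ t
sub σ ⊥' = ⊥'
sub σ (φ ⇒ ψ) = sub σ φ ⇒ sub σ ψ
sub σ (φ ∧' ψ) = sub σ φ ∧' sub σ ψ
sub σ (φ ∨' ψ) = sub σ φ ∨' sub σ ψ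
sub σ (∀' φ) = ∀' (sub (liftS σ) φ)
sub σ (∃' φ) = ∃' (sub (liftS σ) φ)

wk : ∀ {n} → Formula n → Formula (suc n)
wk = ren suc

closed : ∀ {n} → Formula 0 → Formula n
closed = ren (λ ())

sub0 : ∀ {n} → Term n → Fin (suc n) → Term n
sub0 t zero = t
sub0 t (suc i) = var i

_[_] : ∀ {n} → Formula (suc n) → Term n → Formula n
φ [ t ] = sub (sub0 t) φ

_⟨_⟩ : ∀ {n} → Formula 1 → Term n → Formula n
J ⟨ t ⟩ = sub (λ _ → t) J

Theory : Set₁
Theory = Formula 0 → Set

infix 0 Deriv
data Deriv (T : Theory) {n : ℕ} (Γ : List (Formula n)) : Formula n → Set where
  hyp   : ∀ {φ} → φ ∈ Γ → Deriv T Γ φ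
  ax    : ∀ {ψ} → T ψ → Deriv T Γ (closed ψ)
  raa   : ∀ {φ} → Deriv T (¬' φ ∷ Γ) ⊥' → Deriv T Γ φ
  ⇒I    : ∀ {φ ψ} → Deriv T (φ ∷ Γ) ψ → Deriv T Γ (φ ⇒ ψ)
  ⇒E    : ∀ {φ ψ} → Deriv T Γ (φ ⇒ ψ) → Deriv T Γ φ → Deriv T Γ ψ
  ∧I    : ∀ {φ ψ} → Deriv T Γ φ → Deriv T Γ ψ → Deriv T Γ (φ ∧' ψ)
  ∧E₁   : ∀ {φ ψ} → Deriv T Γ (φ ∧' ψ) → Deriv T Γ φ
  ∧E₂   : ∀ {φ ψ} → Deriv T Γ (φ ∧' ψ) → Deriv T Γ ψ
  ∨I₁   : ∀ {φ ψ} → Deriv T Γ φ → Deriv T Γ (φ ∨' ψ)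
  ∨I₂   : ∀ {φ ψ} → Deriv T Γ ψ → Deriv T Γ (φ ∨' ψ)
  ∨E    : ∀ {φ ψ χ} → Deriv T Γ (φ ∨' ψ) → Deriv T (φ ∷ Γ) χ
          → Deriv T (ψ ∷ Γ) χ → Deriv T Γ χ
  ∀I    : ∀ {φ} → Deriv T (map wk Γ) φ → Deriv T Γ (∀' φ)
  ∀E    : ∀ {φ} → Deriv T Γ (∀' φ) → (t : Term n) → Deriv T Γ (φ [ t ])
  ∃I    : ∀ {φ} (t : Term n) → Deriv T Γ (φ [ t ]) → Deriv T Γ (∃' φ)
  ∃E    : ∀ {φ ψ} → Deriv T Γ (∃' φ) → Deriv T (φ ∷ map wk Γ) (wk ψ)
          → Deriv T Γ ψ
  ≐refl : ∀ {t} → Deriv T Γ (t ≐ t)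
  ≐subst : ∀ {s t} (φ : Formula (suc n)) → Deriv T Γ (s ≐ t)
          → Deriv T Γ (φ [ s ]) → Deriv T Γ (φ [ t ])

infix 0 _⊢_
_⊢_ : Theory → Formula 0 → Set
T ⊢ φ = Deriv T [] φ

bit : ∀ {n} → Bool → Term n
bit false = 𝟘
bit true  = 𝟙

-- overline α, left-nested: overline(α b) = overline(α) ∘ b
biteralAcc : ∀ {n} → Term n → List Bool → Term n
biteralAcc t [] = t
biteralAcc t (b ∷ bs) = biteralAcc (t ∘ bit b) bs

biteral : ∀ {n} → List⁺ Bool → Term n
biteral (h ∷ bs) = biteralAcc (bit h) bs

prefs : Bool → List Bool → List (List⁺ Bool)
prefs h [] = (h ∷ []) ∷ []
prefs h (b ∷ bs) = (h ∷ []) ∷ map (h ∷⁺_) (prefs b bs)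

suffs : Bool → List Bool → List (List⁺ Bool)
suffs h [] = (h ∷ []) ∷ []
suffs h (b ∷ bs) = (h ∷ b ∷ bs) ∷ suffs b bs

Pref Suff Sub : List⁺ Bool → List (List⁺ Bool)
Pref (h ∷ bs) = prefs h bs
Suff (h ∷ bs) = suffs h bs
-- nonempty substrings = nonempty suffixes of nonempty prefixes
Sub (h ∷ bs) = concatMap (λ p → suffs (head p) (tail p)) (prefs h bs)

private
  x₃ y₃ z₃ : Term 3
  x₃ = var zero
  y₃ = var (suc zero)
  z₃ = var (suc (suc zero))
  x₂ y₂ : Term 2
  x₂ = var zero
  y₂ = var (suc zero)
  x₁ : Term 1
  x₁ = var zero

data ID4 : Theory where
  assoc   : ID4 (∀' (∀' (∀' (((x₃ ∘ y₃) ∘ z₃) ≐ (x₃ ∘ (y₃ ∘ z₃))))))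
  inj     : ID4 (∀' (∀' ((x₂ ≠ y₂) ⇒ ((x₂ ∘ 𝟘 ≠ y₂ ∘ 𝟘) ∧' (x₂ ∘ 𝟙 ≠ y₂ ∘ 𝟙)))))
  dist01  : ID4 (∀' (∀' (x₂ ∘ 𝟘 ≠ y₂ ∘ 𝟙)))
  not0    : ID4 (∀' (∀' (x₂ ∘ y₂ ≠ 𝟘)))
  not1    : ID4 (∀' (∀' (x₂ ∘ y₂ ≠ 𝟙)))
  prefAx  : (α : List⁺ Bool) → ID4 (∀' ((x₁ ≼ biteral α)
              ⇔' ⋁ (map (λ γ → x₁ ≐ biteral γ) (Pref α))))
  suffAx  : (α : List⁺ Bool) → ID4 (∀' ((x₁ ≼suff biteral α)
              ⇔' ⋁ (map (λ γ → x₁ ≐ biteral γ) (Suff α))))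
  subAx   : (α : List⁺ Bool) → ID4 (∀' ((x₁ ≼sub biteral α)
              ⇔' ⋁ (map (λ γ → x₁ ≐ biteral γ) (Sub α))))

{-# OPTIONS --safe #-}
-- J(z) says that z is a subword of some w all of whose subwords satisfy the
-- conclusions of (2)-(4), and below which ≼sub is transitive.  Then (2)-(4)
-- hold under J because z is itself such a subword, and (5) holds with the same
-- witness w by the built-in transitivity.  For (1), every closed term is
-- provably equal to a biteral ᾱ, and w = ᾱ works: by the axioms the subwords
-- of ᾱ are exactly the biterals of substrings of α, and for a biteral β̄ ∘ c
-- properties (2)-(4) reduce, via injectivity of _∘ c, to facts about strings.
module Submission where

open import Defs
open import Data.Nat using (ℕ; suc)
open import Data.Fin using (Fin; zero; suc)
open import Data.Bool using (Bool; true; false)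
open import Data.Bool.Properties using () renaming (_≟_ to _≟ᵇ_)
open import Data.Empty using (⊥-elim)
open import Data.Product using (Σ; _×_; ∃; _,_)
open import Data.List using (List; []; _∷_; map; _++_)
open import Data.List.NonEmpty using (List⁺; _∷_; _∷⁺_; toList; _++⁺_; _⁺++⁺_; _⁺∷ʳ_; snocView; _∷ʳ′_)
open import Data.List.Properties using (++-assoc; ++-identityʳ; ∷-injectiveʳ)
open import Data.List.Membership.Propositional using (_∈_; lose; find)
open import Data.List.Membership.Propositional.Properties using (∈-map⁺; ∈-map⁻; ∈-concatMap⁺; ∈-concatMap⁻)
open import Data.List.Relation.Unary.Any using (here; there)
open import Data.List.Relation.Binary.Subset.Propositional using (_⊆_)
open import Data.List.Relation.Binary.Subset.Propositional.Properties using (∷⁺ʳ; map⁺; xs⊆x∷xs)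
open import Relation.Nullary using (yes; no)
open import Relation.Binary.PropositionalEquality using (_≡_; _≢_; refl; sym; trans; cong; cong₂; subst; ≢-sym; module ≡-Reasoning)

private
  variable
    n m : ℕ
    T : Theory
    Γ Δ : List (Formula n)

∈-Suff⁺ : ∀ α γ p → toList α ≡ p ++ toList γ → γ ∈ Suff α
∈-Suff⁺ (h ∷ [])     γ []          refl = here refl
∈-Suff⁺ (h ∷ b ∷ bs) γ []          refl = here refl
∈-Suff⁺ (h ∷ [])     γ (x ∷ [])    ()
∈-Suff⁺ (h ∷ [])     γ (x ∷ y ∷ p) ()
∈-Suff⁺ (h ∷ b ∷ bs) γ (x ∷ p)     e    = there (∈-Suff⁺ (b ∷ bs) γ p (∷-injectiveʳ e))

∈-Suff⁻ : ∀ α γ → γ ∈ Suff α → ∃ λ p → toList α ≡ p ++ toList γ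
∈-Suff⁻ (h ∷ [])     γ (here refl) = [] , refl
∈-Suff⁻ (h ∷ b ∷ bs) γ (here refl) = [] , refl
∈-Suff⁻ (h ∷ b ∷ bs) γ (there γ∈) =
  let p , e = ∈-Suff⁻ (b ∷ bs) γ γ∈ in h ∷ p , cong (h ∷_) e

∈-prefs⁺ : ∀ h bs γ s → h ∷ bs ≡ toList γ ++ s → γ ∈ prefs h bs
∈-prefs⁺ h []       (g ∷ [])      s refl = here refl
∈-prefs⁺ h (b ∷ bs) (g ∷ [])      s refl = here refl
∈-prefs⁺ h []       (g ∷ g′ ∷ gs) s ()
∈-prefs⁺ h (b ∷ bs) (g ∷ g′ ∷ gs) s refl =
  there (∈-map⁺ (g ∷⁺_) (∈-prefs⁺ g′ (gs ++ s) (g′ ∷ gs) s refl))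

∈-prefs⁻ : ∀ h bs γ → γ ∈ prefs h bs → ∃ λ s → h ∷ bs ≡ toList γ ++ s
∈-prefs⁻ h []       γ (here refl) = [] , refl
∈-prefs⁻ h (b ∷ bs) γ (here refl) = b ∷ bs , refl
∈-prefs⁻ h (b ∷ bs) γ (there γ∈) with ∈-map⁻ (h ∷⁺_) γ∈
... | δ , δ∈ , refl = let s , e = ∈-prefs⁻ b bs δ δ∈ in s , cong (h ∷_) e

toList-++⁺ : ∀ {A : Set} (p : List A) (γ : List⁺ A) → toList (p ++⁺ γ) ≡ p ++ toList γ
toList-++⁺ []      γ = refl
toList-++⁺ (x ∷ p) γ = cong (x ∷_) (toList-++⁺ p γ)

∈-Sub⁺ : ∀ α γ p s → toList α ≡ p ++ (toList γ ++ s) → γ ∈ Sub α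
∈-Sub⁺ α@(h ∷ bs) γ p s e =
  ∈-concatMap⁺ Suff (lose p++γ∈Pref (∈-Suff⁺ (p ++⁺ γ) γ p (toList-++⁺ p γ)))
  where
  p++γ∈Pref : (p ++⁺ γ) ∈ prefs h bs
  p++γ∈Pref = ∈-prefs⁺ h bs (p ++⁺ γ) s (begin
    toList α                     ≡⟨ e ⟩
    p ++ (toList γ ++ s)         ≡⟨ ++-assoc p (toList γ) s ⟨
    (p ++ toList γ) ++ s         ≡⟨ cong (_++ s) (toList-++⁺ p γ) ⟨
    toList (p ++⁺ γ) ++ s        ∎)
    where open ≡-Reasoning

∈-Sub⁻ : ∀ α γ → γ ∈ Sub α → ∃ λ p → ∃ λ s → toList α ≡ p ++ (toList γ ++ s)
∈-Sub⁻ (h ∷ bs) γ γ∈ with find (∈-concatMap⁻ Suff {xs = prefs h bs} γ∈)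
... | π , π∈ , γ∈π with ∈-prefs⁻ h bs π π∈ | ∈-Suff⁻ π γ γ∈π
... | s , e₁ | p , e₂ = p , s , (begin
  h ∷ bs                 ≡⟨ e₁ ⟩
  toList π ++ s          ≡⟨ cong (_++ s) e₂ ⟩
  (p ++ toList γ) ++ s   ≡⟨ ++-assoc p (toList γ) s ⟩
  p ++ (toList γ ++ s)   ∎)
  where open ≡-Reasoning

∈-Sub-refl : ∀ α → α ∈ Sub α
∈-Sub-refl α = ∈-Sub⁺ α α [] [] (sym (++-identityʳ (toList α)))

∈-Sub-trans : ∀ {α γ δ} → γ ∈ Sub α → δ ∈ Sub γ → δ ∈ Sub α
∈-Sub-trans {α} {γ} {δ} γ∈ δ∈ with ∈-Sub⁻ α γ γ∈ | ∈-Sub⁻ γ δ δ∈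
... | p , s , e₁ | p′ , s′ , e₂ = ∈-Sub⁺ α δ (p ++ p′) (s′ ++ s) (begin
  toList α                            ≡⟨ e₁ ⟩
  p ++ (toList γ ++ s)                ≡⟨ cong (λ w → p ++ (w ++ s)) e₂ ⟩
  p ++ ((p′ ++ (toList δ ++ s′)) ++ s) ≡⟨ cong (p ++_) (++-assoc p′ _ s) ⟩
  p ++ (p′ ++ ((toList δ ++ s′) ++ s)) ≡⟨ ++-assoc p p′ _ ⟨
  (p ++ p′) ++ ((toList δ ++ s′) ++ s) ≡⟨ cong ((p ++ p′) ++_) (++-assoc (toList δ) s′ s) ⟩
  (p ++ p′) ++ (toList δ ++ (s′ ++ s)) ∎)
  where open ≡-Reasoning

init-∈-Sub : ∀ β c → β ∈ Sub (β ⁺∷ʳ c)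
init-∈-Sub β c = ∈-Sub⁺ (β ⁺∷ʳ c) β [] (c ∷ []) refl

last-∈-Suff : ∀ β c → (c ∷ []) ∈ Suff (β ⁺∷ʳ c)
last-∈-Suff β c = ∈-Suff⁺ (β ⁺∷ʳ c) (c ∷ []) (toList β) refl

∈-Suff-⁺∷ʳ : ∀ {β δ} c → δ ∈ Suff β → (δ ⁺∷ʳ c) ∈ Suff (β ⁺∷ʳ c)
∈-Suff-⁺∷ʳ {β} {δ} c δ∈ with ∈-Suff⁻ β δ δ∈
... | p , e = ∈-Suff⁺ (β ⁺∷ʳ c) (δ ⁺∷ʳ c) p (begin
  toList β ++ c ∷ []          ≡⟨ cong (_++ c ∷ []) e ⟩
  (p ++ toList δ) ++ c ∷ []   ≡⟨ ++-assoc p (toList δ) _ ⟩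
  p ++ (toList δ ++ c ∷ [])   ∎)
  where open ≡-Reasoning

wkT : Term n → Term (suc n)
wkT = renT suc

sub0-wkT : ∀ (s u : Term n) → subT (sub0 s) (wkT u) ≡ u
sub0-wkT s (var i) = refl
sub0-wkT s 𝟘       = refl
sub0-wkT s 𝟙       = refl
sub0-wkT s (u ∘ v) = cong₂ _∘_ (sub0-wkT s u) (sub0-wkT s v)

liftS-wkT : ∀ (σ : Fin n → Term m) u → subT (liftS σ) (wkT u) ≡ wkT (subT σ u)
liftS-wkT σ (var i) = refl
liftS-wkT σ 𝟘       = refl
liftS-wkT σ 𝟙       = refl
liftS-wkT σ (u ∘ v) = cong₂ _∘_ (liftS-wkT σ u) (liftS-wkT σ v)

sub0-liftS-wkT² : ∀ (s t u : Term n) → subT (sub0 s) (subT (liftS (sub0 t)) (wkT (wkT u))) ≡ u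
sub0-liftS-wkT² s t u = trans (cong (subT (sub0 s)) (liftS-wkT (sub0 t) (wkT u))) (trans (sub0-wkT s _) (sub0-wkT t u))

renT-subT : ∀ (ρ : Fin n → Fin m) t → renT ρ t ≡ subT (λ i → var (ρ i)) t
renT-subT ρ (var i) = refl
renT-subT ρ 𝟘       = refl
renT-subT ρ 𝟙       = refl
renT-subT ρ (u ∘ v) = cong₂ _∘_ (renT-subT ρ u) (renT-subT ρ v)

subT-biteralAcc : ∀ (σ : Fin n → Term m) t bs → subT σ (biteralAcc t bs) ≡ biteralAcc (subT σ t) bs
subT-biteralAcc σ t []           = refl
subT-biteralAcc σ t (false ∷ bs) = subT-biteralAcc σ (t ∘ 𝟘) bs
subT-biteralAcc σ t (true ∷ bs)  = subT-biteralAcc σ (t ∘ 𝟙) bs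

subT-biteral : ∀ (σ : Fin n → Term m) α → subT σ (biteral α) ≡ biteral α
subT-biteral σ (false ∷ bs) = subT-biteralAcc σ 𝟘 bs
subT-biteral σ (true ∷ bs)  = subT-biteralAcc σ 𝟙 bs

renT-biteral : ∀ (ρ : Fin n → Fin m) α → renT ρ (biteral α) ≡ biteral α
renT-biteral ρ α = trans (renT-subT ρ (biteral α)) (subT-biteral _ α)

wkT-biteral : ∀ α → wkT {n} (biteral α) ≡ biteral α
wkT-biteral = renT-biteral suc

wkT²-biteral : ∀ α → wkT (wkT {n} (biteral α)) ≡ biteral α
wkT²-biteral α = trans (cong wkT (wkT-biteral α)) (wkT-biteral α)

_≐-any_ : Term n → List (List⁺ Bool) → Formula n
t ≐-any γs = ⋁ (map (λ γ → t ≐ biteral γ) γs)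

ren-≐-any : ∀ (ρ : Fin n → Fin m) t γs → ren ρ (t ≐-any γs) ≡ renT ρ t ≐-any γs
ren-≐-any ρ t []       = refl
ren-≐-any ρ t (γ ∷ γs) = cong₂ _∨'_ (cong (renT ρ t ≐_) (renT-biteral ρ γ)) (ren-≐-any ρ t γs)

sub-≐-any : ∀ (σ : Fin n → Term m) t γs → sub σ (t ≐-any γs) ≡ subT σ t ≐-any γs
sub-≐-any σ t []       = refl
sub-≐-any σ t (γ ∷ γs) = cong₂ _∨'_ (cong (subT σ t ≐_) (subT-biteral σ γ)) (sub-≐-any σ t γs)

sub0-liftR-biteral : ∀ (t : Term n) (ρ : Fin m → Fin n) α →
                     subT (sub0 t) (renT (liftR ρ) (biteral α)) ≡ biteral α
sub0-liftR-biteral t ρ α = trans (cong (subT (sub0 t)) (renT-biteral (liftR ρ) α)) (subT-biteral (sub0 t) α)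

sub0-liftR-≐-any : ∀ (t : Term n) (ρ : Fin m → Fin n) γs →
                   sub (sub0 t) (ren (liftR ρ) (var zero ≐-any γs)) ≡ t ≐-any γs
sub0-liftR-≐-any t ρ γs =
  trans (cong (sub (sub0 t)) (ren-≐-any (liftR ρ) (var zero) γs)) (sub-≐-any (sub0 t) (var zero) γs)

weaken : ∀ {φ} → Γ ⊆ Δ → Deriv T Γ φ → Deriv T Δ φ
weaken Γ⊆Δ (hyp φ∈)       = hyp (Γ⊆Δ φ∈)
weaken Γ⊆Δ (ax Tψ)        = ax Tψ
weaken Γ⊆Δ (raa d)        = raa (weaken (∷⁺ʳ _ Γ⊆Δ) d)
weaken Γ⊆Δ (⇒I d)         = ⇒I (weaken (∷⁺ʳ _ Γ⊆Δ) d)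
weaken Γ⊆Δ (⇒E d e)       = ⇒E (weaken Γ⊆Δ d) (weaken Γ⊆Δ e)
weaken Γ⊆Δ (∧I d e)       = ∧I (weaken Γ⊆Δ d) (weaken Γ⊆Δ e)
weaken Γ⊆Δ (∧E₁ d)        = ∧E₁ (weaken Γ⊆Δ d)
weaken Γ⊆Δ (∧E₂ d)        = ∧E₂ (weaken Γ⊆Δ d)
weaken Γ⊆Δ (∨I₁ d)        = ∨I₁ (weaken Γ⊆Δ d)
weaken Γ⊆Δ (∨I₂ d)        = ∨I₂ (weaken Γ⊆Δ d)
weaken Γ⊆Δ (∨E d e f)     = ∨E (weaken Γ⊆Δ d) (weaken (∷⁺ʳ _ Γ⊆Δ) e) (weaken (∷⁺ʳ _ Γ⊆Δ) f)
weaken Γ⊆Δ (∀I d)         = ∀I (weaken (map⁺ wk Γ⊆Δ) d)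
weaken Γ⊆Δ (∀E d t)       = ∀E (weaken Γ⊆Δ d) t
weaken Γ⊆Δ (∃I t d)       = ∃I t (weaken Γ⊆Δ d)
weaken Γ⊆Δ (∃E d e)       = ∃E (weaken Γ⊆Δ d) (weaken (∷⁺ʳ _ (map⁺ wk Γ⊆Δ)) e)
weaken Γ⊆Δ ≐refl          = ≐refl
weaken Γ⊆Δ (≐subst φ e d) = ≐subst φ (weaken Γ⊆Δ e) (weaken Γ⊆Δ d)

weaken₁ : ∀ {φ ψ} → Deriv T Γ φ → Deriv T (ψ ∷ Γ) φ
weaken₁ = weaken (xs⊆x∷xs _ _)

exfalso : ∀ {χ} → Deriv T Γ ⊥' → Deriv T Γ χ
exfalso d = raa (weaken₁ d)

≐-replace : ∀ (φ : Formula (suc n)) {s t A B} → φ [ s ] ≡ A → φ [ t ] ≡ B →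
            Deriv T Γ (s ≐ t) → Deriv T Γ A → Deriv T Γ B
≐-replace φ refl refl = ≐subst φ

≐-sym : ∀ {s t} → Deriv T Γ (s ≐ t) → Deriv T Γ (t ≐ s)
≐-sym {s = s} {t = t} e = ≐-replace (var zero ≐ wkT s)
  (cong (s ≐_) (sub0-wkT s s)) (cong (t ≐_) (sub0-wkT t s)) e ≐refl

≐-trans : ∀ {s t u} → Deriv T Γ (s ≐ t) → Deriv T Γ (t ≐ u) → Deriv T Γ (s ≐ u)
≐-trans {s = s} {t = t} {u = u} e₁ e₂ = ≐-replace (wkT s ≐ var zero)
  (cong (_≐ t) (sub0-wkT t s)) (cong (_≐ u) (sub0-wkT u s)) e₂ e₁

∘-congˡ : ∀ {s t u} → Deriv T Γ (s ≐ t) → Deriv T Γ (s ∘ u ≐ t ∘ u)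
∘-congˡ {s = s} {t = t} {u = u} e = ≐-replace (wkT s ∘ wkT u ≐ var zero ∘ wkT u)
  (cong₂ (λ a b → a ∘ b ≐ s ∘ b) (sub0-wkT s s) (sub0-wkT s u))
  (cong₂ (λ a b → a ∘ b ≐ t ∘ b) (sub0-wkT t s) (sub0-wkT t u)) e ≐refl

∘-congʳ : ∀ {s t u} → Deriv T Γ (s ≐ t) → Deriv T Γ (u ∘ s ≐ u ∘ t)
∘-congʳ {s = s} {t = t} {u = u} e = ≐-replace (wkT u ∘ wkT s ≐ wkT u ∘ var zero)
  (cong₂ (λ a b → a ∘ b ≐ a ∘ s) (sub0-wkT s u) (sub0-wkT s s))
  (cong₂ (λ a b → a ∘ b ≐ a ∘ t) (sub0-wkT t u) (sub0-wkT t s)) e ≐refl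

≼suff-congˡ : ∀ {s t u} → Deriv T Γ (s ≐ t) → Deriv T Γ (s ≼suff u) → Deriv T Γ (t ≼suff u)
≼suff-congˡ {s = s} {t = t} {u = u} = ≐-replace (var zero ≼suff wkT u)
  (cong (s ≼suff_) (sub0-wkT s u)) (cong (t ≼suff_) (sub0-wkT t u))

≼suff-congʳ : ∀ {s t u} → Deriv T Γ (s ≐ t) → Deriv T Γ (u ≼suff s) → Deriv T Γ (u ≼suff t)
≼suff-congʳ {s = s} {t = t} {u = u} = ≐-replace (wkT u ≼suff var zero)
  (cong (_≼suff s) (sub0-wkT s u)) (cong (_≼suff t) (sub0-wkT t u))

≼sub-congʳ : ∀ {s t u} → Deriv T Γ (s ≐ t) → Deriv T Γ (u ≼sub s) → Deriv T Γ (u ≼sub t)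
≼sub-congʳ {s = s} {t = t} {u = u} = ≐-replace (wkT u ≼sub var zero)
  (cong (_≼sub s) (sub0-wkT s u)) (cong (_≼sub t) (sub0-wkT t u))

≐-any-intro : ∀ {t γ γs} → γ ∈ γs → Deriv T Γ (t ≐ biteral γ) → Deriv T Γ (t ≐-any γs)
≐-any-intro (here refl) d = ∨I₁ d
≐-any-intro (there γ∈)  d = ∨I₂ (≐-any-intro γ∈ d)

≐-any-elim : ∀ {t χ} γs → Deriv T Γ (t ≐-any γs) →
             (∀ {γ} → γ ∈ γs → Deriv T ((t ≐ biteral γ) ∷ Γ) χ) → Deriv T Γ χ
≐-any-elim []       d k = exfalso d
≐-any-elim (γ ∷ γs) d k =
  ∨E d (k (here refl))
     (≐-any-elim γs (hyp (here refl)) λ γ∈ → weaken (∷⁺ʳ _ (xs⊆x∷xs _ _)) (k (there γ∈)))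

forEachBit : (Bool → Formula n) → Formula n
forEachBit P = P false ∧' P true

forSomeBit : (Bool → Formula n) → Formula n
forSomeBit P = P false ∨' P true

forEachBit-intro : ∀ {P} → (∀ a → Deriv T Γ (P a)) → Deriv T Γ (forEachBit P)
forEachBit-intro d = ∧I (d false) (d true)

forEachBit-elim : ∀ {P} → Deriv T Γ (forEachBit P) → ∀ a → Deriv T Γ (P a)
forEachBit-elim d false = ∧E₁ d
forEachBit-elim d true  = ∧E₂ d

forSomeBit-intro : ∀ {P} a → Deriv T Γ (P a) → Deriv T Γ (forSomeBit P)
forSomeBit-intro false = ∨I₁
forSomeBit-intro true  = ∨I₂

∘-assoc : ∀ a b c → Deriv ID4 Γ ((a ∘ b) ∘ c ≐ a ∘ (b ∘ c))
∘-assoc a b c = subst (Deriv ID4 _)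
  (cong₂ (λ b′ c′ → (a ∘ b′) ∘ c′ ≐ a ∘ (b′ ∘ c′)) (sub0-wkT a b)
    (sub0-liftS-wkT² a b c))
  (∀E (∀E (∀E (ax assoc) c) b) a)

∘-bit-injective : ∀ {s t} a → Deriv ID4 Γ (s ∘ bit a ≐ t ∘ bit a) → Deriv ID4 Γ (s ≐ t)
∘-bit-injective {s = s} {t = t} a e =
  raa (⇒E (forEachBit-elim {P = λ b → s ∘ bit b ≠ t ∘ bit b} (⇒E s≠t⇒∘bit≠∘bit (hyp (here refl))) a)
          (weaken₁ e))
  where
  s≠t⇒∘bit≠∘bit : Deriv ID4 Δ ((s ≠ t) ⇒ forEachBit (λ b → s ∘ bit b ≠ t ∘ bit b))
  s≠t⇒∘bit≠∘bit = subst (Deriv ID4 _)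
    (cong (λ t′ → (s ≠ t′) ⇒ ((s ∘ 𝟘 ≠ t′ ∘ 𝟘) ∧' (s ∘ 𝟙 ≠ t′ ∘ 𝟙))) (sub0-wkT s t))
    (∀E (∀E (ax inj) t) s)

∘𝟘≠∘𝟙 : ∀ s t → Deriv ID4 Γ (s ∘ 𝟘 ≠ t ∘ 𝟙)
∘𝟘≠∘𝟙 s t = subst (Deriv ID4 _) (cong (λ t′ → s ∘ 𝟘 ≠ t′ ∘ 𝟙) (sub0-wkT s t))
  (∀E (∀E (ax dist01) t) s)

∘≠bit : ∀ s t c → Deriv ID4 Γ (s ∘ t ≠ bit c)
∘≠bit s t false = subst (Deriv ID4 _) (cong (λ t′ → s ∘ t′ ≠ 𝟘) (sub0-wkT s t))
  (∀E (∀E (ax not0) t) s)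
∘≠bit s t true  = subst (Deriv ID4 _) (cong (λ t′ → s ∘ t′ ≠ 𝟙) (sub0-wkT s t))
  (∀E (∀E (ax not1) t) s)

≼suff-biteral⇔ : ∀ t α → Deriv ID4 Γ ((t ≼suff biteral α) ⇔' (t ≐-any Suff α))
≼suff-biteral⇔ t α = subst (Deriv ID4 _)
  (cong₂ (λ b φ → ((t ≼suff b) ⇒ φ) ∧' (φ ⇒ (t ≼suff b)))
    (sub0-liftR-biteral t _ α) (sub0-liftR-≐-any t _ (Suff α)))
  (∀E (ax (suffAx α)) t)

≼sub-biteral⇔ : ∀ t α → Deriv ID4 Γ ((t ≼sub biteral α) ⇔' (t ≐-any Sub α))
≼sub-biteral⇔ t α = subst (Deriv ID4 _)
  (cong₂ (λ b φ → ((t ≼sub b) ⇒ φ) ∧' (φ ⇒ (t ≼sub b)))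
    (sub0-liftR-biteral t _ α) (sub0-liftR-≐-any t _ (Sub α)))
  (∀E (ax (subAx α)) t)

∘-bit-distinct : ∀ {c a} → c ≢ a → ∀ s t → Deriv ID4 Γ (s ∘ bit c ≠ t ∘ bit a)
∘-bit-distinct {c = false} {a = true}  _   s t = ∘𝟘≠∘𝟙 s t
∘-bit-distinct {c = true}  {a = false} _   s t = ⇒I (⇒E (weaken₁ (∘𝟘≠∘𝟙 t s)) (≐-sym (hyp (here refl))))
∘-bit-distinct {c = false} {a = false} c≢a _ _ = ⊥-elim (c≢a refl)
∘-bit-distinct {c = true}  {a = true}  c≢a _ _ = ⊥-elim (c≢a refl)

≼suff-biteral-elim : ∀ {t α} → Deriv ID4 Γ (t ≼suff biteral α) → Deriv ID4 Γ (t ≐-any Suff α)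
≼suff-biteral-elim {t = t} {α = α} = ⇒E (∧E₁ (≼suff-biteral⇔ t α))

≼suff-biteral-intro : ∀ {t α γ} → γ ∈ Suff α →
                      Deriv ID4 Γ (t ≐ biteral γ) → Deriv ID4 Γ (t ≼suff biteral α)
≼suff-biteral-intro {t = t} {α = α} γ∈ e = ⇒E (∧E₂ (≼suff-biteral⇔ t α)) (≐-any-intro γ∈ e)

≼sub-biteral-elim : ∀ {t α} → Deriv ID4 Γ (t ≼sub biteral α) → Deriv ID4 Γ (t ≐-any Sub α)
≼sub-biteral-elim {t = t} {α = α} = ⇒E (∧E₁ (≼sub-biteral⇔ t α))

≼sub-biteral-intro : ∀ {t α γ} → γ ∈ Sub α →
                     Deriv ID4 Γ (t ≐ biteral γ) → Deriv ID4 Γ (t ≼sub biteral α)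
≼sub-biteral-intro {t = t} {α = α} γ∈ e = ⇒E (∧E₂ (≼sub-biteral⇔ t α)) (≐-any-intro γ∈ e)

biteralAcc-++ : ∀ (t : Term n) xs ys → biteralAcc t (xs ++ ys) ≡ biteralAcc (biteralAcc t xs) ys
biteralAcc-++ t []       ys = refl
biteralAcc-++ t (x ∷ xs) ys = biteralAcc-++ (t ∘ bit x) xs ys

biteral-⁺∷ʳ : ∀ β c → biteral {n} (β ⁺∷ʳ c) ≡ biteral β ∘ bit c
biteral-⁺∷ʳ (h ∷ bs) c = biteralAcc-++ (bit h) bs (c ∷ [])

biteralAcc-cong : ∀ {s t} bs → Deriv ID4 Γ (s ≐ t) → Deriv ID4 Γ (biteralAcc s bs ≐ biteralAcc t bs)
biteralAcc-cong []       e = e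
biteralAcc-cong (b ∷ bs) e = biteralAcc-cong bs (∘-congˡ e)

∘-biteralAcc : ∀ s t bs → Deriv ID4 Γ (s ∘ biteralAcc t bs ≐ biteralAcc (s ∘ t) bs)
∘-biteralAcc s t []       = ≐refl
∘-biteralAcc s t (b ∷ bs) =
  ≐-trans (∘-biteralAcc s (t ∘ bit b) bs) (biteralAcc-cong bs (≐-sym (∘-assoc s t (bit b))))

∘-biteral : ∀ α β → Deriv ID4 Γ (biteral α ∘ biteral β ≐ biteral (α ⁺++⁺ β))
∘-biteral (a ∷ as) (b ∷ bs) = subst (Deriv ID4 _) (cong (biteral (a ∷ as) ∘ biteral (b ∷ bs) ≐_)
  (sym (biteralAcc-++ (bit a) as (b ∷ bs)))) (∘-biteralAcc _ (bit b) bs)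

bitString : Term 0 → List⁺ Bool
bitString 𝟘       = false ∷ []
bitString 𝟙       = true ∷ []
bitString (s ∘ t) = bitString s ⁺++⁺ bitString t

≐-biteral-bitString : ∀ t → Deriv ID4 Γ (t ≐ biteral (bitString t))
≐-biteral-bitString 𝟘       = ≐refl
≐-biteral-bitString 𝟙       = ≐refl
≐-biteral-bitString (s ∘ t) =
  ≐-trans (≐-trans (∘-congˡ (≐-biteral-bitString s)) (∘-congʳ (≐-biteral-bitString t)))
          (∘-biteral (bitString s) (bitString t))

LastBitIsSuffix : Term n → Term n → Bool → Formula n
LastBitIsSuffix z x a = (z ≐ x ∘ bit a) ⇒ (bit a ≼suff z)

SuffixExtends : Term n → Term n → Term n → Bool → Formula n
SuffixExtends z x y a = ((z ≐ y ∘ bit a) ∧' (x ≼suff y)) ⇒ (x ∘ bit a ≼suff z)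

BitExtends : Term n → Term n → Formula n
BitExtends z u = (u ≼sub z) ∧' forSomeBit λ a → z ≐ u ∘ bit a

BitOrBitExtension : Term n → Formula n
BitOrBitExtension z = (z ≐ 𝟘) ∨' (z ≐ 𝟙) ∨' ∃' (BitExtends (wkT z) (var zero))

-- the conclusions of (2), (3) and (4) at z
Admissible : Term n → Formula n
Admissible z = ∀' (forEachBit (LastBitIsSuffix (wkT z) (var zero)))
            ∧' ∀' (∀' (forEachBit (SuffixExtends (wkT (wkT z)) (var (suc zero)) (var zero))))
            ∧' BitOrBitExtension z

Hereditary : Term n → Formula n
Hereditary w = ∀' ((var zero ≼sub wkT w) ⇒ Admissible (var zero))
            ∧' ∀' (∀' ((var zero ≼sub var (suc zero)) ⇒ (var (suc zero) ≼sub wkT (wkT w))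
                         ⇒ (var zero ≼sub wkT (wkT w))))

BelowHereditary : Term n → Formula n
BelowHereditary z = ∃' ((wkT z ≼sub var zero) ∧' Hereditary (var zero))

J : Formula 1
J = BelowHereditary (var zero)

bit-≼suff-∘bit : ∀ β c → Deriv ID4 Γ (bit c ≼suff biteral β ∘ bit c)
bit-≼suff-∘bit β c = subst (Deriv ID4 _) (cong (λ z → bit c ≼suff z) (biteral-⁺∷ʳ β c))
  (≼suff-biteral-intro {α = β ⁺∷ʳ c} (last-∈-Suff β c) ≐refl)

∘bit-≼suff-∘bit : ∀ {β δ} c → δ ∈ Suff β →
                  Deriv ID4 Γ (biteral δ ∘ bit c ≼suff biteral β ∘ bit c)
∘bit-≼suff-∘bit {β = β} {δ = δ} c δ∈ =
  subst (Deriv ID4 _) (cong₂ _≼suff_ (biteral-⁺∷ʳ δ c) (biteral-⁺∷ʳ β c))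
  (≼suff-biteral-intro {α = β ⁺∷ʳ c} (∈-Suff-⁺∷ʳ c δ∈) ≐refl)

lastBitIsSuffix-⁺∷ʳ : ∀ β c x a → Deriv ID4 Γ (LastBitIsSuffix (biteral β ∘ bit c) x a)
lastBitIsSuffix-⁺∷ʳ β c x a with a ≟ᵇ c
... | no a≢c   = ⇒I (exfalso (⇒E (∘-bit-distinct (≢-sym a≢c) _ _) (hyp (here refl))))
... | yes refl = ⇒I (weaken₁ (bit-≼suff-∘bit β a))

suffixExtends-⁺∷ʳ : ∀ β c x y a → Deriv ID4 Γ (SuffixExtends (biteral β ∘ bit c) x y a)
suffixExtends-⁺∷ʳ β c x y a with a ≟ᵇ c
... | no a≢c   = ⇒I (exfalso (⇒E (∘-bit-distinct (≢-sym a≢c) _ _) (∧E₁ (hyp (here refl)))))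
... | yes refl = ⇒I (≐-any-elim (Suff β) (≼suff-biteral-elim {α = β} x≼β) λ δ∈ →
      ≼suff-congˡ (∘-congˡ (≐-sym (hyp (here refl)))) (∘bit-≼suff-∘bit a δ∈))
  where
  x≼β : Deriv ID4 (((biteral β ∘ bit a ≐ y ∘ bit a) ∧' (x ≼suff y)) ∷ Γ) (x ≼suff biteral β)
  x≼β = ≼suff-congʳ (≐-sym (∘-bit-injective a (∧E₁ (hyp (here refl))))) (∧E₂ (hyp (here refl)))

lastBitIsSuffix-biteral : ∀ α x a → Deriv ID4 Γ (LastBitIsSuffix (biteral α) x a)
lastBitIsSuffix-biteral α x a with snocView α
... | [] ∷ʳ′ c       = ⇒I (exfalso (⇒E (∘≠bit x (bit a) c) (≐-sym (hyp (here refl)))))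
... | (h ∷ hs) ∷ʳ′ c =
  subst (Deriv ID4 _) (cong (λ z → LastBitIsSuffix z x a) (sym (biteral-⁺∷ʳ (h ∷ hs) c)))
    (lastBitIsSuffix-⁺∷ʳ (h ∷ hs) c x a)

suffixExtends-biteral : ∀ α x y a → Deriv ID4 Γ (SuffixExtends (biteral α) x y a)
suffixExtends-biteral α x y a with snocView α
... | [] ∷ʳ′ c       = ⇒I (exfalso (⇒E (∘≠bit y (bit a) c) (≐-sym (∧E₁ (hyp (here refl))))))
... | (h ∷ hs) ∷ʳ′ c =
  subst (Deriv ID4 _) (cong (λ z → SuffixExtends z x y a) (sym (biteral-⁺∷ʳ (h ∷ hs) c)))
    (suffixExtends-⁺∷ʳ (h ∷ hs) c x y a)

bitExtends-⁺∷ʳ : ∀ β c → Deriv ID4 Γ (BitExtends (biteral (β ⁺∷ʳ c)) (biteral β))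
bitExtends-⁺∷ʳ β c = ∧I (≼sub-biteral-intro {α = β ⁺∷ʳ c} (init-∈-Sub β c) ≐refl)
  (forSomeBit-intro {P = λ a → biteral (β ⁺∷ʳ c) ≐ biteral β ∘ bit a} c
    (subst (Deriv ID4 _) (cong (biteral (β ⁺∷ʳ c) ≐_) (biteral-⁺∷ʳ β c)) ≐refl))

bitOrBitExtension-biteral : ∀ α → Deriv ID4 Γ (BitOrBitExtension (biteral α))
bitOrBitExtension-biteral α with snocView α
... | [] ∷ʳ′ false    = ∨I₁ ≐refl
... | [] ∷ʳ′ true     = ∨I₂ (∨I₁ ≐refl)
... | (h ∷ hs) ∷ʳ′ c  = ∨I₂ (∨I₂ (∃I (biteral (h ∷ hs))
  (subst (Deriv ID4 _) (cong (λ z → BitExtends z (biteral (h ∷ hs))) (sym (sub0-wkT _ _)))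
    (bitExtends-⁺∷ʳ (h ∷ hs) c))))

admissible-biteral : ∀ α → Deriv ID4 Γ (Admissible (biteral α))
admissible-biteral α = ∧I
  (∀I (subst (Deriv ID4 _) (cong (λ z → forEachBit (LastBitIsSuffix z (var zero))) (sym (wkT-biteral α)))
        (forEachBit-intro (lastBitIsSuffix-biteral α (var zero)))))
  (∧I (∀I (∀I (subst (Deriv ID4 _)
                (cong (λ z → forEachBit (SuffixExtends z (var (suc zero)) (var zero))) (sym (wkT²-biteral α)))
                (forEachBit-intro (suffixExtends-biteral α _ _)))))
      (bitOrBitExtension-biteral α))

hereditary-biteral : ∀ α → Deriv ID4 Γ (Hereditary (biteral α))
hereditary-biteral α = ∧I
  (∀I (subst (Deriv ID4 _) (cong (λ w → (var zero ≼sub w) ⇒ Admissible (var zero)) (sym (wkT-biteral α)))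
        (⇒I subwordsAdmissible)))
  (∀I (∀I (subst (Deriv ID4 _)
        (cong (λ w → (var zero ≼sub var (suc zero)) ⇒ (var (suc zero) ≼sub w) ⇒ (var zero ≼sub w))
              (sym (wkT²-biteral α)))
        (⇒I (⇒I subwordsTransitive)))))
  where
  subwordsAdmissible : Deriv ID4 ((var zero ≼sub biteral α) ∷ Δ) (Admissible (var zero))
  subwordsAdmissible = ≐-any-elim (Sub α) (≼sub-biteral-elim {α = α} (hyp (here refl))) λ {γ} _ →
    ≐subst (Admissible (var zero)) (≐-sym (hyp (here refl))) (admissible-biteral γ)

  subwordsTransitive : Deriv ID4 ((var (suc zero) ≼sub biteral α) ∷ (var zero ≼sub var (suc zero)) ∷ Δ)
                                (var zero ≼sub biteral α)
  subwordsTransitive = ≐-any-elim (Sub α) (≼sub-biteral-elim {α = α} (hyp (here refl))) λ {γ} γ∈ →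
    ≐-any-elim (Sub γ)
      (≼sub-biteral-elim {α = γ} (≼sub-congʳ (hyp (here refl)) (hyp (there (there (here refl))))))
      λ δ∈ → ≼sub-biteral-intro {α = α} (∈-Sub-trans {α = α} γ∈ δ∈) (hyp (here refl))

belowHereditary-biteral : ∀ α → Deriv ID4 Γ (BelowHereditary (biteral α))
belowHereditary-biteral α = ∃I (biteral α)
  (subst (Deriv ID4 _) (cong (λ z → (z ≼sub biteral α) ∧' Hereditary (biteral α)) (sym (sub0-wkT _ _)))
    (∧I (≼sub-biteral-intro {α = α} (∈-Sub-refl α) ≐refl) (hereditary-biteral α)))

J-closed : (t : Term 0) → ID4 ⊢ J ⟨ t ⟩
J-closed t = ≐subst J (≐-sym (≐-biteral-bitString t)) (belowHereditary-biteral (bitString t))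

J⇒admissible : Deriv ID4 Γ (J ⟨ var zero ⟩) → Deriv ID4 Γ (Admissible (var zero))
J⇒admissible d = ∃E d (⇒E (∀E (∧E₁ (∧E₂ (hyp (here refl)))) (var (suc zero))) (∧E₁ (hyp (here refl))))

hereditary-≼sub-trans : ∀ {u z w} → Deriv ID4 Γ (Hereditary w) →
                        Deriv ID4 Γ (u ≼sub z) → Deriv ID4 Γ (z ≼sub w) → Deriv ID4 Γ (u ≼sub w)
hereditary-≼sub-trans {u = u} {z = z} {w = w} h u≼z z≼w =
  ⇒E (⇒E (subst (Deriv ID4 _)
            (cong₂ (λ z′ w′ → (u ≼sub z′) ⇒ (z′ ≼sub w′) ⇒ (u ≼sub w′)) (sub0-wkT u z) (sub0-liftS-wkT² u z w))
            (∀E (∀E (∧E₂ h) z) u))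
          u≼z)
     z≼w

J-≼sub : {Γ : List (Formula (suc (suc n)))} →
         Deriv ID4 Γ ((J ⟨ var (suc zero) ⟩ ∧' (var zero ≼sub var (suc zero))) ⇒ J ⟨ var zero ⟩)
J-≼sub = ⇒I (∃E (∧E₁ (hyp (here refl))) (∃I (var zero)
  (∧I (hereditary-≼sub-trans (∧E₂ (hyp (here refl))) (∧E₂ (hyp (there (here refl))))
                              (∧E₁ (hyp (here refl))))
      (∧E₂ (hyp (here refl))))))

mainTheorem11 : Σ (Formula 1) λ J →
      ((t : Term 0) → ID4 ⊢ J ⟨ t ⟩)
    × (ID4 ⊢ ∀' (∀' (J ⟨ var zero ⟩ ⇒
          (((var zero ≐ var (suc zero) ∘ 𝟘) ⇒ (𝟘 ≼suff var zero))
        ∧' ((var zero ≐ var (suc zero) ∘ 𝟙) ⇒ (𝟙 ≼suff var zero))))))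
    × (ID4 ⊢ ∀' (∀' (∀' (J ⟨ var zero ⟩ ⇒
          ((((var zero ≐ var (suc zero) ∘ 𝟘) ∧' (var (suc (suc zero)) ≼suff var (suc zero)))
              ⇒ (var (suc (suc zero)) ∘ 𝟘 ≼suff var zero))
        ∧' (((var zero ≐ var (suc zero) ∘ 𝟙) ∧' (var (suc (suc zero)) ≼suff var (suc zero)))
              ⇒ (var (suc (suc zero)) ∘ 𝟙 ≼suff var zero)))))))
    × (ID4 ⊢ ∀' (J ⟨ var zero ⟩ ⇒
          ((var zero ≐ 𝟘) ∨' (var zero ≐ 𝟙)
        ∨' ∃' ((var zero ≼sub var (suc zero))
              ∧' ((var (suc zero) ≐ var zero ∘ 𝟘) ∨' (var (suc zero) ≐ var zero ∘ 𝟙))))))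
    × (ID4 ⊢ ∀' (∀' ((J ⟨ var (suc zero) ⟩ ∧' (var zero ≼sub var (suc zero)))
          ⇒ J ⟨ var zero ⟩)))
mainTheorem11 = J , J-closed
  , ∀I (∀I (⇒I (∀E (∧E₁ (J⇒admissible (hyp (here refl)))) (var (suc zero)))))
  , ∀I (∀I (∀I (⇒I (∀E (∀E (∧E₁ (∧E₂ (J⇒admissible (hyp (here refl))))) (var (suc (suc zero)))) (var (suc zero))))))
  , ∀I (⇒I (∧E₂ (∧E₂ (J⇒admissible (hyp (here refl))))))
  , ∀I (∀I J-≼sub)
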